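{- Let $k\ge 1$, $j\ge 1$ and $n$ be positive integers, and let $e_1,\dots,e_k$ be nonnegative integers with $\sum_{i=1}^k e_i\ge\binom{n}{2}$. If $n\ge 2kj-j+1$, then there is an index $i$ with $e_i\ge j(n-j)$; i.e., $K_n$ can be split into vertex-disjoint complete graphs $K_{n-j}$ and $K_j$ and all $j(n-j)$ edges between them colored with a single color $i$ without exceeding $e_i$. Moreover, for $j=1$ the same conclusion (some $e_i\ge n-1$) also holds when $n=2k-1$.
   Context: In this setting an $(n,k)$-sequence is allowed to have total sum at least $\binom{n}{2}$ (rather than exactly $\binom{n}{2}$); $e_i$ is regarded as the number of available edges of color $i$. -}

-- If every colour had fewer than t edges, the k colours together would have at most
-- k (t - 1) edges, so it suffices that 2 k (t - 1) < n (n - 1) = 2 (n choose 2).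
-- For t = j (n - j) this inequality follows from n ≥ 2kj - j + 1, and for j = 1 it
-- also holds at n = 2k - 1, where 2k (t - 1) = 2k (2k - 3) = n (n - 1) - 2.
module Submission where

open import Data.Nat using (ℕ; zero; suc; _+_; _*_; _∸_; _≤_; _≥_; _<_; z≤n; _≤?_)
open import Data.Nat.Properties
open import Data.Nat.Combinatorics using (_C_; nCk+nC[k+1]≡[n+1]C[k+1]; nC1≡n)
open import Data.Fin using (zero; suc)
open import Data.Vec using (Vec; []; _∷_; sum; lookup)
open import Data.Product using (_×_; _,_; ∃-syntax)
open import Data.Sum using (_⊎_; inj₁; inj₂)
open import Relation.Nullary using (yes; no; contradiction)
open import Relation.Binary.PropositionalEquality
  using (_≡_; refl; sym; trans; cong; subst; module ≡-Reasoning)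
open import Data.Nat.Solver using (module +-*-Solver)
open +-*-Solver

-- The second alternative says sum e ≤ k (t - 1), written without subtraction.
lookup≥⊎sum+length≤ : ∀ {k} (e : Vec ℕ k) (t : ℕ) → (∃[ i ] lookup e i ≥ t) ⊎ (sum e + k ≤ k * t)
lookup≥⊎sum+length≤ [] t = inj₂ z≤n
lookup≥⊎sum+length≤ {suc k} (x ∷ xs) t with t ≤? x
... | yes t≤x = inj₁ (zero , t≤x)
... | no t≰x with lookup≥⊎sum+length≤ xs t
...   | inj₁ (i , t≤xᵢ) = inj₁ (suc i , t≤xᵢ)
...   | inj₂ bound = inj₂ (subst (_≤ t + k * t) (shuffle x (sum xs) k)
                                 (+-mono-≤ (≰⇒> t≰x) bound))
  where
  shuffle : ∀ a b c → suc a + (b + c) ≡ a + b + suc c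
  shuffle = solve 3 (λ a b c → (con 1 :+ a) :+ (b :+ c) := a :+ b :+ (con 1 :+ c)) refl

2*nC2+n≡n*n : ∀ n → 2 * (n C 2) + n ≡ n * n
2*nC2+n≡n*n zero = refl
2*nC2+n≡n*n (suc n) = begin
    2 * (suc n C 2) + suc n
  ≡⟨ cong (λ c → 2 * c + suc n) (sym (nCk+nC[k+1]≡[n+1]C[k+1] n 1)) ⟩
    2 * (n C 1 + n C 2) + suc n
  ≡⟨ cong (λ c → 2 * (c + n C 2) + suc n) (nC1≡n n) ⟩
    2 * (n + n C 2) + suc n
  ≡⟨ regroup n (n C 2) ⟩
    (2 * (n C 2) + n) + (2 * n + 1)
  ≡⟨ cong (_+ (2 * n + 1)) (2*nC2+n≡n*n n) ⟩
    n * n + (2 * n + 1)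
  ≡⟨ square-suc n ⟩
    suc n * suc n ∎
  where
  open ≡-Reasoning
  regroup : ∀ a c → 2 * (a + c) + suc a ≡ (2 * c + a) + (2 * a + 1)
  regroup = solve 2 (λ a c → con 2 :* (a :+ c) :+ (con 1 :+ a)
                           := (con 2 :* c :+ a) :+ (con 2 :* a :+ con 1)) refl
  square-suc : ∀ a → a * a + (2 * a + 1) ≡ suc a * suc a
  square-suc = solve 1 (λ a → a :* a :+ (con 2 :* a :+ con 1) := (con 1 :+ a) :* (con 1 :+ a)) refl

-- The hypothesis on t is 2 k (t - 1) < n (n - 1), again written without subtraction.
sum≥nC2⇒lookup≥ : ∀ {k} (e : Vec ℕ k) (n t : ℕ) → sum e ≥ n C 2 →
                  2 * (k * t) + n < n * n + 2 * k → ∃[ i ] lookup e i ≥ t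
sum≥nC2⇒lookup≥ {k} e n t sum≥ gap with lookup≥⊎sum+length≤ e t
... | inj₁ large = large
... | inj₂ bound = contradiction (<-≤-trans gap too-few) (<-irrefl refl)
  where
  open ≤-Reasoning
  too-few : n * n + 2 * k ≤ 2 * (k * t) + n
  too-few = begin
      n * n + 2 * k
    ≡⟨ cong (_+ 2 * k) (sym (2*nC2+n≡n*n n)) ⟩
      2 * (n C 2) + n + 2 * k
    ≤⟨ +-monoˡ-≤ (2 * k) (+-monoˡ-≤ n (*-monoʳ-≤ 2 sum≥)) ⟩
      2 * sum e + n + 2 * k
    ≡⟨ solve 3 (λ s n k → con 2 :* s :+ n :+ con 2 :* k := con 2 :* (s :+ k) :+ n) refl (sum e) n k ⟩
      2 * (sum e + k) + n
    ≤⟨ +-monoˡ-≤ n (*-monoʳ-≤ 2 bound) ⟩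
      2 * (k * t) + n ∎

2[1+b][1+a]∸[1+a]≡2b[1+a]+[1+a] : ∀ a b → 2 * suc b * suc a ∸ suc a ≡ 2 * b * suc a + suc a
2[1+b][1+a]∸[1+a]≡2b[1+a]+[1+a] a b = trans (cong (_∸ suc a) (expand a b)) (m+n∸m≡n (suc a) _)
  where
  expand : ∀ a b → 2 * suc b * suc a ≡ suc a + (2 * b * suc a + suc a)
  expand = solve 2 (λ a b → con 2 :* (con 1 :+ b) :* (con 1 :+ a)
                         := (con 1 :+ a) :+ (con 2 :* b :* (con 1 :+ a) :+ (con 1 :+ a))) refl

threshold⇒∃slack : ∀ a b n → 2 * suc b * suc a ∸ suc a + 1 ≤ n →
                   ∃[ d ] n ≡ suc a + (2 * b * suc a + 1 + d)
threshold⇒∃slack a b n threshold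
  with m≤n⇒∃[o]m+o≡n (subst (λ c → c + 1 ≤ n) (2[1+b][1+a]∸[1+a]≡2b[1+a]+[1+a] a b) threshold)
... | d , refl = d , solve 3 (λ a b d → con 2 :* b :* (con 1 :+ a) :+ (con 1 :+ a) :+ con 1 :+ d
                                     := (con 1 :+ a) :+ (con 2 :* b :* (con 1 :+ a) :+ con 1 :+ d))
                                     refl a b d

-- With j = 1 + a, k = 1 + b and m = n - j = 2bj + 1 + d, the right side exceeds the left
-- by j a + m d + 2b + 2.
gap-above-threshold : ∀ a b d → let j = suc a; m = 2 * b * suc a + 1 + d in
                      2 * (suc b * (j * m)) + (j + m) < (j + m) * (j + m) + 2 * suc b
gap-above-threshold a b d =
  subst (2 * (suc b * (suc a * m)) + (suc a + m) <_) (sym (expand a b d)) (m≤m+n _ _)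
  where
  m = 2 * b * suc a + 1 + d
  expand : ∀ a b d → let j = suc a; m = 2 * b * suc a + 1 + d in
           (j + m) * (j + m) + 2 * suc b
             ≡ suc (2 * (suc b * (j * m)) + (j + m)) + (j * a + m * d + 2 * b + 1)
  expand = solve 3 (λ a b d → let j = con 1 :+ a; m = con 2 :* b :* j :+ con 1 :+ d in
                    (j :+ m) :* (j :+ m) :+ con 2 :* (con 1 :+ b)
                      := con 1 :+ (con 2 :* ((con 1 :+ b) :* (j :* m)) :+ (j :+ m))
                         :+ (j :* a :+ m :* d :+ con 2 :* b :+ con 1)) refl

gap-at-2k∸1 : ∀ b → 2 * (suc b * (b + b)) + suc (b + b) < suc (b + b) * suc (b + b) + 2 * suc b
gap-at-2k∸1 b = subst (2 * (suc b * (b + b)) + suc (b + b) <_) (sym (expand b)) (n≤1+n _)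
  where
  expand : ∀ b → suc (b + b) * suc (b + b) + 2 * suc b ≡ suc (suc (2 * (suc b * (b + b)) + suc (b + b)))
  expand = solve 1 (λ b → (con 1 :+ (b :+ b)) :* (con 1 :+ (b :+ b)) :+ con 2 :* (con 1 :+ b)
                       := con 2 :+ (con 2 :* ((con 1 :+ b) :* (b :+ b)) :+ (con 1 :+ (b :+ b)))) refl

2[1+b]∸1≡1+2b : ∀ b → 2 * suc b ∸ 1 ≡ suc (b + b)
2[1+b]∸1≡1+2b b = trans (+-suc b (b + 0)) (cong (λ c → suc (b + c)) (+-identityʳ b))

lookup≥j*[n∸j] : ∀ k j n → 1 ≤ k → 1 ≤ j → (e : Vec ℕ k) → sum e ≥ n C 2 →
                 2 * k * j ∸ j + 1 ≤ n → ∃[ i ] lookup e i ≥ j * (n ∸ j)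
lookup≥j*[n∸j] (suc b) (suc a) n _ _ e sum≥ threshold with threshold⇒∃slack a b n threshold
... | d , refl = subst (λ t → ∃[ i ] lookup e i ≥ suc a * t) (sym (m+n∸m≡n (suc a) _))
                       (sum≥nC2⇒lookup≥ e _ _ sum≥ (gap-above-threshold a b d))

lookup≥n∸1 : ∀ k n → 1 ≤ k → (e : Vec ℕ k) → sum e ≥ n C 2 →
             n ≡ 2 * k ∸ 1 → ∃[ i ] lookup e i ≥ n ∸ 1
lookup≥n∸1 (suc b) n _ e sum≥ n≡2k∸1 with trans n≡2k∸1 (2[1+b]∸1≡1+2b b)
... | refl = sum≥nC2⇒lookup≥ e _ _ sum≥ (gap-at-2k∸1 b)

lemma2p5 : (k j n : ℕ) → 1 ≤ k → 1 ≤ j → 1 ≤ n → (e : Vec ℕ k) → sum e ≥ n C 2 →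
           ((2 * k * j ∸ j + 1 ≤ n → ∃[ i ] lookup e i ≥ j * (n ∸ j))
           × (j ≡ 1 → n ≡ 2 * k ∸ 1 → ∃[ i ] lookup e i ≥ n ∸ 1))
lemma2p5 k j n 1≤k 1≤j _ e sum≥ = lookup≥j*[n∸j] k j n 1≤k 1≤j e sum≥ , λ _ → lookup≥n∸1 k n 1≤k e sum≥
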